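{- Let $k\ge 4$ be an integer with $k\not\equiv 0\pmod{4}$. Then the system of Diophantine equations $p^3-q^3=r^3+s^3=t^k-1$ has infinitely many solutions $(p,q,r,s,t)$ in positive integers. -}

module Defs where

open import Data.Nat using (ℕ; _≤_; _<_)
open import Data.Integer using (ℤ; +_; _-_; _+_; _^_; 0ℤ; 1ℤ) renaming (_<_ to _<ℤ_)
open import Data.Product using (_×_; Σ; ∃-syntax)
open import Relation.Binary.PropositionalEquality using (_≡_)

IsSolution : ℕ → ℤ → ℤ → ℤ → ℤ → ℤ → Set
IsSolution k p q r s t =
  (0ℤ <ℤ p) × (0ℤ <ℤ q) × (0ℤ <ℤ r) × (0ℤ <ℤ s) × (0ℤ <ℤ t) ×
  (p ^ 3 - q ^ 3 ≡ r ^ 3 + s ^ 3) × (r ^ 3 + s ^ 3 ≡ t ^ k - 1ℤ)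

-- Infinitely many solutions: for every bound B there is a solution with
-- p + q + r + s + t > B (positive components, so this is equivalent to
-- the solution set not being contained in any finite box).
InfinitelyManySolutions : ℕ → Set
InfinitelyManySolutions k =
  (B : ℕ) → ∃[ p ] ∃[ q ] ∃[ r ] ∃[ s ] ∃[ t ]
    (IsSolution k p q r s t × (+ B <ℤ p + q + r + s + t))

-- Mahler's identity p³ + 1 = q³ + (9a⁴)³ for p = 9a⁴ + 3a, q = 9a³ + 1 gives
-- p³ - q³ = (9a⁴)³ - 1, and replacing a by -a (which fixes 9a⁴) gives
-- r³ + s³ = (9a⁴)³ - 1 with r = 9a⁴ - 3a, s = 9a³ - 1.  It remains to make
-- (9a⁴)³ = 3⁶ a¹² a k-th power: with a = 3ⁿ and t = 3ᶠ this asks for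
-- f k = 6 + 12 n, which is solvable exactly when k ≢ 0 (mod 4), and then
-- for infinitely many f.
module Submission where

open import Defs
open import Data.Nat using (ℕ; _≤_; _%_)
open import Relation.Binary.PropositionalEquality using (_≢_)

open import Data.Nat using (zero; suc; pred; _+_; _*_; _^_; _<_; NonZero; s≤s; z≤n)
open import Data.Nat.Properties
  using (n<1+n; ≤-trans; ≤-<-trans; m≤n+m; m≤n*m; ^-*-assoc; ^-distribˡ-+-*; *-comm;
         m^n>0; m^n≢0; ^-monoʳ-<; ^-monoʳ-≤; module ≤-Reasoning)
open import Data.Nat.Solver using (module +-*-Solver)
import Data.Nat.Tactic.RingSolver as ℕ-Ring
open import Data.Integer as ℤ using (ℤ; +_; 1ℤ; +<+)
open import Data.Integer.Properties using (pos-*)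
import Data.Integer.Tactic.RingSolver as ℤ-Ring
open import Data.List using (_∷_; [])
open import Data.Product using (_×_; _,_; ∃₂)
open import Data.Empty using (⊥-elim)
open import Relation.Binary.PropositionalEquality
  using (_≡_; refl; sym; trans; cong; module ≡-Reasoning)

n<m^n : ∀ m → 1 < m → ∀ n → n < m ^ n
n<m^n m 1<m zero    = s≤s z≤n
n<m^n m 1<m (suc n) = ≤-<-trans (n<m^n m 1<m n) (^-monoʳ-< m 1<m (n<1+n n))

pos-^ : ∀ m n → + (m ^ n) ≡ (+ m) ℤ.^ n
pos-^ m zero    = refl
pos-^ m (suc n) = trans (pos-* m (m ^ n)) (cong (+ m ℤ.*_) (pos-^ m n))

multiple≡6+12e : ∀ k → k % 4 ≢ 0 → ∃₂ λ g e → 3 * g * k ≡ 6 + 12 * e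
multiple≡6+12e 0 k≢0 = ⊥-elim (k≢0 refl)
multiple≡6+12e 1 _   = 2 , 0 , refl
multiple≡6+12e 2 _   = 1 , 0 , refl
multiple≡6+12e 3 _   = 2 , 1 , refl
-- (4 + k) % 4 computes to k % 4, so k≢0 can be passed on unchanged.
multiple≡6+12e (suc (suc (suc (suc k)))) k≢0 with multiple≡6+12e k k≢0
... | g , e , eq = g , g + e , (begin
  3 * g * (4 + k)       ≡⟨ ℕ-Ring.solve (g ∷ k ∷ []) ⟩
  12 * g + 3 * g * k    ≡⟨ cong (_+_ (12 * g)) eq ⟩
  12 * g + (6 + 12 * e) ≡⟨ ℕ-Ring.solve (g ∷ e ∷ []) ⟩
  6 + 12 * (g + e)      ∎)
  where open ≡-Reasoning

exponent-shift : ∀ {f k n} → f * k ≡ 6 + 12 * n →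
                 ∀ j → (f + 12 * j) * k ≡ 6 + 12 * (n + j * k)
exponent-shift {f} {k} {n} eq j = begin
  (f + 12 * j) * k          ≡⟨ ℕ-Ring.solve (f ∷ j ∷ k ∷ []) ⟩
  f * k + 12 * (j * k)      ≡⟨ cong (_+ 12 * (j * k)) eq ⟩
  6 + 12 * n + 12 * (j * k) ≡⟨ ℕ-Ring.solve (n ∷ j ∷ k ∷ []) ⟩
  6 + 12 * (n + j * k)      ∎
  where open ≡-Reasoning

P Q X : ℕ → ℕ
P a = 3 * a + 9 * a ^ 4
Q a = 1 + 9 * a ^ 3
X a = 9 * a ^ 4

-- R b = 9a⁴ - 3a and S b = 9a³ - 1 for a = 1 + b, expanded so that no
-- subtraction occurs.
R S : ℕ → ℕ
R b = 6 + 33 * b + 54 * b ^ 2 + 36 * b ^ 3 + 9 * b ^ 4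
S b = 8 + 27 * b + 27 * b ^ 2 + 9 * b ^ 3

open +-*-Solver using (solve; con; _:+_; _:*_; _:^_; _:=_)

P³+1≡Q³+X³ : ∀ a → P a ^ 3 + 1 ≡ Q a ^ 3 + X a ^ 3
P³+1≡Q³+X³ = solve 1 (λ a →
  (con 3 :* a :+ con 9 :* a :^ 4) :^ 3 :+ con 1
    := (con 1 :+ con 9 :* a :^ 3) :^ 3 :+ (con 9 :* a :^ 4) :^ 3) refl

R³+S³+1≡X³ : ∀ b → R b ^ 3 + S b ^ 3 + 1 ≡ X (suc b) ^ 3
R³+S³+1≡X³ = solve 1 (λ b →
  (con 6 :+ con 33 :* b :+ con 54 :* b :^ 2 :+ con 36 :* b :^ 3 :+ con 9 :* b :^ 4) :^ 3
    :+ (con 8 :+ con 27 :* b :+ con 27 :* b :^ 2 :+ con 9 :* b :^ 3) :^ 3 :+ con 1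
    := (con 9 :* (con 1 :+ b) :^ 4) :^ 3) refl

729a¹²≡X³ : ∀ a → 729 * a ^ 12 ≡ X a ^ 3
729a¹²≡X³ = solve 1 (λ a → con 729 :* a :^ 12 := (con 9 :* a :^ 4) :^ 3) refl

3^f^k≡X[3^n]³ : ∀ {f k n} → f * k ≡ 6 + 12 * n → (3 ^ f) ^ k ≡ X (3 ^ n) ^ 3
3^f^k≡X[3^n]³ {f} {k} {n} eq = begin
  (3 ^ f) ^ k        ≡⟨ ^-*-assoc 3 f k ⟩
  3 ^ (f * k)        ≡⟨ cong (3 ^_) eq ⟩
  3 ^ (6 + 12 * n)   ≡⟨ ^-distribˡ-+-* 3 6 (12 * n) ⟩
  729 * 3 ^ (12 * n) ≡⟨ cong (λ e → 729 * 3 ^ e) (*-comm 12 n) ⟩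
  729 * 3 ^ (n * 12) ≡⟨ cong (729 *_) (^-*-assoc 3 n 12) ⟨
  729 * (3 ^ n) ^ 12 ≡⟨ 729a¹²≡X³ (3 ^ n) ⟩
  X (3 ^ n) ^ 3      ∎
  where open ≡-Reasoning

difference-system : ∀ {x y u w : ℤ} → x ℤ.+ 1ℤ ≡ y ℤ.+ w → u ℤ.+ 1ℤ ≡ w →
                    (x ℤ.- y ≡ u) × (u ≡ w ℤ.- 1ℤ)
difference-system {x} {y} {u} {w} eq₁ eq₂ = x-y≡u , u≡w-1
  where
  open ≡-Reasoning
  u≡w-1 : u ≡ w ℤ.- 1ℤ
  u≡w-1 = begin
    u               ≡⟨ ℤ-Ring.solve (u ∷ []) ⟩
    u ℤ.+ 1ℤ ℤ.- 1ℤ ≡⟨ cong (ℤ._- 1ℤ) eq₂ ⟩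
    w ℤ.- 1ℤ        ∎
  x-y≡u : x ℤ.- y ≡ u
  x-y≡u = begin
    x ℤ.- y                 ≡⟨ ℤ-Ring.solve (x ∷ y ∷ []) ⟩
    x ℤ.+ 1ℤ ℤ.- (y ℤ.+ 1ℤ) ≡⟨ cong (ℤ._- (y ℤ.+ 1ℤ)) eq₁ ⟩
    y ℤ.+ w ℤ.- (y ℤ.+ 1ℤ)  ≡⟨ ℤ-Ring.solve (y ∷ w ∷ []) ⟩
    w ℤ.- 1ℤ                ≡⟨ u≡w-1 ⟨
    u                       ∎

solution-from-tᵏ≡X³ : ∀ k a t .{{_ : NonZero a}} → 0 < t → t ^ k ≡ X a ^ 3 →
                      IsSolution k (+ P a) (+ Q a) (+ R (pred a)) (+ S (pred a)) (+ t)
solution-from-tᵏ≡X³ k a@(suc b) t t>0 t^k≡X³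
  rewrite sym (pos-^ (P a) 3) | sym (pos-^ (Q a) 3) | sym (pos-^ (R b) 3)
        | sym (pos-^ (S b) 3) | sym (pos-^ t k) =
  +<+ (s≤s z≤n) , +<+ (s≤s z≤n) , +<+ (s≤s z≤n) , +<+ (s≤s z≤n) , +<+ t>0 ,
  difference-system {+ (P a ^ 3)} {+ (Q a ^ 3)} (cong +_ P³+1≡Q³+tᵏ) (cong +_ R³+S³+1≡tᵏ)
  where
  P³+1≡Q³+tᵏ : P a ^ 3 + 1 ≡ Q a ^ 3 + t ^ k
  P³+1≡Q³+tᵏ = trans (P³+1≡Q³+X³ a) (cong (_+_ (Q a ^ 3)) (sym t^k≡X³))
  R³+S³+1≡tᵏ : R b ^ 3 + S b ^ 3 + 1 ≡ t ^ k
  R³+S³+1≡tᵏ = trans (R³+S³+1≡X³ b) (sym t^k≡X³)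

mainTheorem7 : (k : ℕ) → 4 ≤ k → k % 4 ≢ 0 → InfinitelyManySolutions k
mainTheorem7 k _ k≢0 B with multiple≡6+12e k k≢0
... | g , e , eq =
  + P a , + Q a , + R (pred a) , + S (pred a) , + t ,
  solution-from-tᵏ≡X³ k a t (m^n>0 3 f) t^k≡X³ , +<+ B<sum
  where
  f t n a : ℕ
  f = 3 * g + 12 * B
  t = 3 ^ f
  n = e + B * k
  a = 3 ^ n
  instance a≢0 : NonZero a
  a≢0 = m^n≢0 3 n
  t^k≡X³ : t ^ k ≡ X a ^ 3
  t^k≡X³ = 3^f^k≡X[3^n]³ {f} {k} {n} (exponent-shift {3 * g} {k} {e} eq B)
  open ≤-Reasoning
  B<sum : B < P a + Q a + R (pred a) + S (pred a) + t
  B<sum = begin-strict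
    B      <⟨ n<m^n 3 (s≤s (s≤s z≤n)) B ⟩
    3 ^ B  ≤⟨ ^-monoʳ-≤ 3 (≤-trans (m≤n*m B 12) (m≤n+m (12 * B) (3 * g))) ⟩
    t      ≤⟨ m≤n+m t _ ⟩
    P a + Q a + R (pred a) + S (pred a) + t ∎
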